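{- Let $\Psi\subseteq\Delta^+_\ell$ be a root ideal, and let $z$ be the lowest (largest-index) nonempty row of $\Psi$. Assume $\Psi$ has no wall among rows $1,\dots,z$, i.e. for $1\le r<z$ rows $r$ and $r+1$ of $\Psi$ have different numbers of elements. Then for every $2\le p\le\ell$, $$\mathrm{mtop}_\Psi(p)=\max\{\mathrm{top}_\Psi(p),\ \mathrm{top}_\Psi(p-1)+1\}.$$
   Context: $\Delta^+_\ell=\{(i,j):1\le i<j\le\ell\}$. A root ideal is $\Psi\subseteq\Delta^+_\ell$ with $(i,j)\in\Psi$ and $i'\le i<j\le j'$ implying $(i',j')\in\Psi$. Row $r$ of $\Psi$ is $\{(r,j)\in\Psi\}$. A root $(i,j)\in\Psi$ is removable if $\Psi\setminus\{(i,j)\}$ is a root ideal. The bounce graph of $\Psi$ has vertices $\{1,\dots,\ell\}$ and an edge $j\to i$ (a bounce edge) for each removable root $(i,j)$; each vertex has at most one outgoing edge. $\mathrm{top}_\Psi(p)$ is the smallest vertex of the connected component containing $p$. A bounce edge $p\to q$ is a mirror edge if $p-1\to q-1$ is also a bounce edge. Starting from $p=p_0$, follow outgoing bounce edges $p_0\to p_1\to\cdots\to p_L$ as long as each edge $p_{i}\to p_{i+1}$ is a mirror edge, with $L\ge0$ maximal. Then $\mathrm{mtop}_\Psi(p):=p_L$, so $\mathrm{mtop}_\Psi(p)=p$ if there is no mirror edge out of $p$. -}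

module Defs where

open import Data.Nat using (ℕ; zero; suc; _+_; _∸_; _≤_; _<_; _⊔_; _≡ᵇ_)
open import Data.Bool using (Bool; true; false; _∧_; not; if_then_else_)
open import Data.List using (List; map; upTo)
open import Data.Nat.ListAction using (sum)
open import Data.Product using (_×_; Σ; ∃)
open import Relation.Binary.PropositionalEquality using (_≡_)
open import Relation.Nullary using (¬_)
open import Relation.Binary.Construct.Closure.Equivalence using (EqClosure)

Subset₂ : Set
Subset₂ = ℕ → ℕ → Bool

_∋₂_,_ : Subset₂ → ℕ → ℕ → Set
Ψ ∋₂ i , j = Ψ i j ≡ true

record IsRootIdeal (ℓ : ℕ) (Ψ : Subset₂) : Set where
  field
    inΔ⁺   : ∀ i j → Ψ ∋₂ i , j → (1 ≤ i) × (i < j) × (j ≤ ℓ)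
    closed : ∀ i j i' j' → Ψ ∋₂ i , j → 1 ≤ i' → i' ≤ i → j ≤ j' → j' ≤ ℓ →
             Ψ ∋₂ i' , j'

remove : Subset₂ → ℕ → ℕ → Subset₂
remove Ψ a b i j = Ψ i j ∧ not ((i ≡ᵇ a) ∧ (j ≡ᵇ b))

Removable : ℕ → Subset₂ → ℕ → ℕ → Set
Removable ℓ Ψ i j = (Ψ ∋₂ i , j) × IsRootIdeal ℓ (remove Ψ i j)

BounceEdge : ℕ → Subset₂ → ℕ → ℕ → Set
BounceEdge ℓ Ψ p q = Removable ℓ Ψ q p

Connected : ℕ → Subset₂ → ℕ → ℕ → Set
Connected ℓ Ψ = EqClosure (BounceEdge ℓ Ψ)

IsTop : ℕ → Subset₂ → ℕ → ℕ → Set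
IsTop ℓ Ψ p t =
  (1 ≤ t) × (t ≤ ℓ) × Connected ℓ Ψ p t ×
  (∀ v → 1 ≤ v → v ≤ ℓ → Connected ℓ Ψ p v → t ≤ v)

MirrorEdge : ℕ → Subset₂ → ℕ → ℕ → Set
MirrorEdge ℓ Ψ p q = BounceEdge ℓ Ψ p q × BounceEdge ℓ Ψ (p ∸ 1) (q ∸ 1)

data MirrorPath (ℓ : ℕ) (Ψ : Subset₂) : ℕ → ℕ → Set where
  stop : ∀ {p} → MirrorPath ℓ Ψ p p
  step : ∀ {p q m} → MirrorEdge ℓ Ψ p q → MirrorPath ℓ Ψ q m → MirrorPath ℓ Ψ p m

-- m = mtop_Ψ(p): end of the maximal mirror-edge path starting at p
-- (outgoing bounce edges are unique, so the path is determined by p)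
IsMtop : ℕ → Subset₂ → ℕ → ℕ → Set
IsMtop ℓ Ψ p m = MirrorPath ℓ Ψ p m × (∀ q → ¬ MirrorEdge ℓ Ψ m q)

rowSize : ℕ → Subset₂ → ℕ → ℕ
rowSize ℓ Ψ r = sum (map (λ j → if Ψ r j then 1 else 0) (upTo (suc ℓ)))

IsLowestNonemptyRow : ℕ → Subset₂ → ℕ → Set
IsLowestNonemptyRow ℓ Ψ z =
  (1 ≤ z) × (z ≤ ℓ) × (∃ λ j → Ψ ∋₂ z , j) × (∀ r j → z < r → ¬ (Ψ ∋₂ r , j))

NoWallUpTo : ℕ → Subset₂ → ℕ → Set
NoWallUpTo ℓ Ψ z = ∀ r → 1 ≤ r → r < z → ¬ (rowSize ℓ Ψ r ≡ rowSize ℓ Ψ (suc r))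

-- A removable root (q, p) is the bottom of column p and the start of row q of Ψ.
-- Every vertex above the top of its component has a (unique, decreasing) bounce
-- edge, so t₁ < p and t₂ < p - 1 give edges p → q and p - 1 → q'.  Without walls,
-- row q - 1 must contain p - 1 (otherwise rows q - 1 and q coincide), which forces
-- q' = q - 1: the edge p → q is a mirror edge, and the tops of q and q - 1 are still
-- t₁ and t₂.  Iterating down to max(t₁, t₂ + 1), where no mirror edge can leave,
-- gives the claim.
module Submission where

open import Defs
open import Data.Nat using (ℕ; zero; suc; _≤_; _<_; _⊔_; _∸_; _≡ᵇ_; z≤n; s≤s)
open import Data.Nat.Properties
  using (≡⇒≡ᵇ; ≡ᵇ⇒≡; ≤-refl; ≤-trans; <⇒≤; <⇒≢; >⇒≢; <-cmp; <⇒≱; ≮⇒≥; <-≤-trans;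
         n≤1+n; <⇒≤pred; m≤n⇒m<n∨m≡n; ⊔-lub; m⊔n<o⇒m<o; m⊔n<o⇒n<o)
open import Data.Nat.Induction using (<-wellFounded)
open import Data.Bool using (true; false; if_then_else_)
open import Data.Bool.Properties using (∧-identityʳ; ∧-zeroʳ; ⇔→≡; _≟_)
open import Data.Product using (_×_; _,_; proj₁; proj₂; ∃)
open import Data.Sum using (_⊎_; inj₁; inj₂)
open import Data.Empty using (⊥; ⊥-elim)
open import Data.List using (upTo)
open import Data.List.Properties using (map-cong)
open import Data.Nat.ListAction using (sum)
open import Function.Base using (_$_)
open import Function.Bundles using (_⇔_; mk⇔)
open import Function.Construct.Composition using (_⇔-∘_)
open import Function.Construct.Symmetry using (⇔-sym)
open import Induction.WellFounded using (Acc; acc)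
open import Relation.Nullary using (¬_)
open import Relation.Nullary.Decidable using (decidable-stable)
open import Relation.Binary using (tri<; tri≈; tri>)
open import Relation.Binary.PropositionalEquality
open import Relation.Binary.Construct.Closure.ReflexiveTransitive using (Star; ε; _◅_; _◅◅_; return)
open import Relation.Binary.Construct.Closure.Symmetric using (fwd; bwd)
import Relation.Binary.Construct.Closure.Equivalence as EqClosure

remove-drops : ∀ Ψ i j → ¬ remove Ψ i j ∋₂ i , j
remove-drops Ψ i j with i ≡ᵇ i | ≡⇒≡ᵇ i i refl | j ≡ᵇ j | ≡⇒≡ᵇ j j refl
... | true | _ | true | _ rewrite ∧-zeroʳ (Ψ i j) = λ ()

remove-keeps : ∀ {Ψ i j a b} → Ψ ∋₂ a , b → (a , b) ≢ (i , j) → remove Ψ i j ∋₂ a , b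
remove-keeps {Ψ} {i} {j} {a} {b} h ne with a ≡ᵇ i | ≡ᵇ⇒≡ a i | b ≡ᵇ j | ≡ᵇ⇒≡ b j
... | true  | a≡i | true  | b≡j = ⊥-elim (ne (cong₂ _,_ (a≡i _) (b≡j _)))
... | true  | _   | false | _   = trans (∧-identityʳ (Ψ a b)) h
... | false | _   | _     | _   = trans (∧-identityʳ (Ψ a b)) h

rowSize-cong : ∀ ℓ Ψ r r' → (∀ j → Ψ r j ≡ Ψ r' j) → rowSize ℓ Ψ r ≡ rowSize ℓ Ψ r'
rowSize-cong ℓ Ψ r r' same =
  cong sum (map-cong (λ j → cong (λ b → if b then 1 else 0) (same j)) (upTo (suc ℓ)))

module _ {ℓ : ℕ} {Ψ : Subset₂} (Ψ-ideal : IsRootIdeal ℓ Ψ) where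
  open IsRootIdeal Ψ-ideal

  Edge : ℕ → ℕ → Set
  Edge = BounceEdge ℓ Ψ

  removable-minimal : ∀ {i j a b} → Removable ℓ Ψ i j → Ψ ∋₂ a , b →
                      (a , b) ≢ (i , j) → i ≤ a → b ≤ j → ⊥
  removable-minimal {i} {j} (ij∈Ψ , Ψ∖ij-ideal) ab∈Ψ ne i≤a b≤j =
    remove-drops Ψ i j
      (IsRootIdeal.closed Ψ∖ij-ideal _ _ i j (remove-keeps {Ψ} ab∈Ψ ne) 1≤i i≤a b≤j j≤ℓ)
    where
    1≤i = proj₁ (inΔ⁺ i j ij∈Ψ)
    j≤ℓ = proj₂ (proj₂ (inΔ⁺ i j ij∈Ψ))

  removable-bottom : ∀ {i j a} → Removable ℓ Ψ i j → i < a → ¬ Ψ ∋₂ a , j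
  removable-bottom rem i<a aj∈Ψ =
    removable-minimal rem aj∈Ψ (λ e → >⇒≢ i<a (cong proj₁ e)) (<⇒≤ i<a) ≤-refl

  removable-leftmost : ∀ {i j b} → Removable ℓ Ψ i j → b < j → ¬ Ψ ∋₂ i , b
  removable-leftmost rem b<j ib∈Ψ =
    removable-minimal rem ib∈Ψ (λ e → <⇒≢ b<j (cong proj₂ e)) ≤-refl (<⇒≤ b<j)

  edge-decreasing : ∀ {p q} → Edge p q → q < p
  edge-decreasing (qp∈Ψ , _) = proj₁ (proj₂ (inΔ⁺ _ _ qp∈Ψ))

  edge-target-positive : ∀ {p q} → Edge p q → 1 ≤ q
  edge-target-positive (qp∈Ψ , _) = proj₁ (inΔ⁺ _ _ qp∈Ψ)

  edge-source-≤ℓ : ∀ {p q} → Edge p q → p ≤ ℓ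
  edge-source-≤ℓ (qp∈Ψ , _) = proj₂ (proj₂ (inΔ⁺ _ _ qp∈Ψ))

  edge-functional : ∀ {p q q'} → Edge p q → Edge p q' → q ≡ q'
  edge-functional {q = q} {q'} e e' with <-cmp q q'
  ... | tri< q<q' _ _ = ⊥-elim (removable-bottom e q<q' (proj₁ e'))
  ... | tri≈ _ q≡q' _ = q≡q'
  ... | tri> _ _ q'<q = ⊥-elim (removable-bottom e' q'<q (proj₁ e))

  Descends : ℕ → ℕ → Set
  Descends = Star Edge

  descends⇒≥ : ∀ {v p} → Descends v p → p ≤ v
  descends⇒≥ ε = ≤-refl
  descends⇒≥ (e ◅ d) = ≤-trans (descends⇒≥ d) (<⇒≤ (edge-decreasing e))

  -- Walking an undirected path back from its end, a backward step either cancels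
  -- the last forward edge (outgoing edges are unique) or is an edge out of the end.
  connected⇒descends⊎edge : ∀ {v p} → Connected ℓ Ψ v p → Descends v p ⊎ ∃ (Edge p)
  connected⇒descends⊎edge ε = inj₁ ε
  connected⇒descends⊎edge (fwd e ◅ c) with connected⇒descends⊎edge c
  ... | inj₁ d = inj₁ (e ◅ d)
  ... | inj₂ out = inj₂ out
  connected⇒descends⊎edge (bwd e ◅ c) with connected⇒descends⊎edge c
  ... | inj₂ out = inj₂ out
  ... | inj₁ ε = inj₂ (_ , e)
  ... | inj₁ (e' ◅ d) rewrite edge-functional e' e = inj₁ d

  edge-out-of-non-minimal : ∀ {p t} → Connected ℓ Ψ p t → t < p → ∃ (Edge p)
  edge-out-of-non-minimal c t<p with connected⇒descends⊎edge (EqClosure.symmetric Edge c)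
  ... | inj₁ d = ⊥-elim (<⇒≱ t<p (descends⇒≥ d))
  ... | inj₂ out = out

  top-of-connected : ∀ {p q t} → IsTop ℓ Ψ p t → Connected ℓ Ψ p q → IsTop ℓ Ψ q t
  top-of-connected (1≤t , t≤ℓ , pt , minimal) pq =
    1≤t , t≤ℓ , EqClosure.symmetric Edge pq ◅◅ pt , λ v 1≤v v≤ℓ qv → minimal v 1≤v v≤ℓ (pq ◅◅ qv)

  top≤self : ∀ {p t} → IsTop ℓ Ψ p t → 1 ≤ p → p ≤ ℓ → t ≤ p
  top≤self (_ , _ , _ , minimal) 1≤p p≤ℓ = minimal _ 1≤p p≤ℓ ε

  top≤edge-target : ∀ {p q t} → IsTop ℓ Ψ p t → Edge p q → t ≤ q
  top≤edge-target (_ , _ , _ , minimal) e =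
    minimal _ (edge-target-positive e) (<⇒≤ (<-≤-trans (edge-decreasing e) (edge-source-≤ℓ e)))
            (return (fwd e))

  RowStartsAt : ℕ → ℕ → Set
  RowStartsAt r p = Ψ ∋₂ r , p × (∀ j → j < p → ¬ Ψ ∋₂ r , j)

  row-interval : ∀ {r p j} → RowStartsAt r p → Ψ ∋₂ r , j ⇔ (p ≤ j × j ≤ ℓ)
  row-interval {r} {p} {j} (rp∈Ψ , before-p) = mk⇔ to from
    where
    to : Ψ ∋₂ r , j → p ≤ j × j ≤ ℓ
    to rj∈Ψ = ≮⇒≥ (λ j<p → before-p j j<p rj∈Ψ) , proj₂ (proj₂ (inΔ⁺ r j rj∈Ψ))
    from : p ≤ j × j ≤ ℓ → Ψ ∋₂ r , j
    from (p≤j , j≤ℓ) = closed r p r j rp∈Ψ (proj₁ (inΔ⁺ r p rp∈Ψ)) ≤-refl p≤j j≤ℓ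

  rowSize-startsAt : ∀ {r r' p} → RowStartsAt r p → RowStartsAt r' p →
                     rowSize ℓ Ψ r ≡ rowSize ℓ Ψ r'
  rowSize-startsAt {r} {r'} start start' = rowSize-cong ℓ Ψ r r' λ j →
    ⇔→≡ (⇔-sym (row-interval start') ⇔-∘ row-interval start)

  removable-startsAt : ∀ {i j} → Removable ℓ Ψ i j → RowStartsAt i j
  removable-startsAt rem = proj₁ rem , λ _ b<j → removable-leftmost rem b<j

  mirror-target-≥tops : ∀ {p q t₁ t₂} → IsTop ℓ Ψ (suc p) t₁ → IsTop ℓ Ψ p t₂ →
                        MirrorEdge ℓ Ψ (suc p) q → t₁ ⊔ suc t₂ ≤ q
  mirror-target-≥tops {q = zero} _ _ (e , _) with edge-target-positive e
  ... | ()
  mirror-target-≥tops {q = suc q} top₁ top₂ (e , e') =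
    ⊔-lub (top≤edge-target top₁ e) (s≤s (top≤edge-target top₂ e'))

  no-mirror-edge-at-tops : ∀ {p q t₁ t₂} → IsTop ℓ Ψ (suc p) t₁ → IsTop ℓ Ψ p t₂ →
                           t₁ ⊔ suc t₂ ≡ suc p → ¬ MirrorEdge ℓ Ψ (suc p) q
  no-mirror-edge-at-tops {q = q} top₁ top₂ tops≡p+1 mirror =
    <⇒≱ (edge-decreasing (proj₁ mirror)) (subst (_≤ q) tops≡p+1 (mirror-target-≥tops top₁ top₂ mirror))

  module _ {z : ℕ} (lowest : IsLowestNonemptyRow ℓ Ψ z) (no-wall : NoWallUpTo ℓ Ψ z) where

    nonempty-row≤lowest : ∀ {r j} → Ψ ∋₂ r , j → r ≤ z
    nonempty-row≤lowest {r} {j} rj∈Ψ = ≮⇒≥ λ z<r → proj₂ (proj₂ (proj₂ lowest)) r j z<r rj∈Ψ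

    -- Otherwise row q would also start at p + 1, giving rows q and q + 1 the same size.
    edge-pred-root : ∀ {p q} → Edge (suc p) (suc q) → 1 ≤ q → Ψ ∋₂ q , p
    edge-pred-root {p} {q} e 1≤q = decidable-stable (Ψ q p ≟ true) λ qp∉Ψ →
      no-wall q 1≤q (nonempty-row≤lowest (proj₁ e))
        (rowSize-startsAt (row-q-startsAt qp∉Ψ) (removable-startsAt e))
      where
      p+1≤ℓ = edge-source-≤ℓ e
      row-q-startsAt : ¬ Ψ ∋₂ q , p → RowStartsAt q (suc p)
      row-q-startsAt qp∉Ψ =
          closed (suc q) (suc p) q (suc p) (proj₁ e) 1≤q (n≤1+n q) ≤-refl p+1≤ℓ
        , λ { j (s≤s j≤p) qj∈Ψ → qp∉Ψ (closed q j q p qj∈Ψ 1≤q ≤-refl j≤p (<⇒≤ p+1≤ℓ)) }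

    edges-mirrored : ∀ {p q q'} → Edge (suc p) q → Edge p q' → suc q' ≡ q
    edges-mirrored {p} {q} {q'} e e' with <-cmp (suc q') q
    ... | tri≈ _ q'+1≡q _ = q'+1≡q
    ... | tri> _ _ q<q'+1 = ⊥-elim $
      removable-leftmost e ≤-refl
        (closed q' p q p (proj₁ e') (edge-target-positive e) (<⇒≤pred q<q'+1) ≤-refl
                (≤-trans (n≤1+n p) (edge-source-≤ℓ e)))
    ... | tri< q'+1<q _ _ with q
    ...   | suc q₀ = ⊥-elim $ removable-bottom e' (<⇒≤pred q'+1<q)
                       (edge-pred-root e (≤-trans (edge-target-positive e') (<⇒≤ (<⇒≤pred q'+1<q))))

    mtop-from-tops : ∀ {p t₁ t₂} → Acc _<_ p → 1 ≤ p → suc p ≤ ℓ →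
                     IsTop ℓ Ψ (suc p) t₁ → IsTop ℓ Ψ p t₂ → IsMtop ℓ Ψ (suc p) (t₁ ⊔ suc t₂)
    mtop-from-tops {p} {t₁} {t₂} (acc smaller) 1≤p p+1≤ℓ
                   top₁@(_ , _ , p+1~t₁ , _) top₂@(_ , _ , p~t₂ , _)
      with m≤n⇒m<n∨m≡n (⊔-lub (top≤self top₁ (s≤s z≤n) p+1≤ℓ)
                              (s≤s (top≤self top₂ 1≤p (≤-trans (n≤1+n p) p+1≤ℓ))))
    ... | inj₂ tops≡p+1 =
      subst (IsMtop ℓ Ψ (suc p)) (sym tops≡p+1)
            (stop , λ _ → no-mirror-edge-at-tops top₁ top₂ tops≡p+1)
    ... | inj₁ tops<p+1
      with edge-out-of-non-minimal p+1~t₁ (m⊔n<o⇒m<o t₁ (suc t₂) tops<p+1)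
         | edge-out-of-non-minimal p~t₂ (<⇒≤pred (m⊔n<o⇒n<o t₁ (suc t₂) tops<p+1))
    ... | q , e | q' , e' with edges-mirrored e e'
    ... | refl =
      let path , maximal = mtop-from-tops (smaller (edge-decreasing e')) (edge-target-positive e')
                             (≤-trans (<⇒≤ (edge-decreasing e)) p+1≤ℓ)
                             (top-of-connected top₁ (return (fwd e)))
                             (top-of-connected top₂ (return (fwd e')))
      in step (e , e') path , maximal

lemma3p31 : (ℓ : ℕ) (Ψ : Subset₂) → IsRootIdeal ℓ Ψ →
    (z : ℕ) → IsLowestNonemptyRow ℓ Ψ z → NoWallUpTo ℓ Ψ z →
    (p : ℕ) → 2 ≤ p → p ≤ ℓ →
    (t₁ t₂ : ℕ) → IsTop ℓ Ψ p t₁ → IsTop ℓ Ψ (p ∸ 1) t₂ →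
    IsMtop ℓ Ψ p (t₁ ⊔ suc t₂)
lemma3p31 ℓ Ψ Ψ-ideal z lowest no-wall (suc p) (s≤s 1≤p) p+1≤ℓ t₁ t₂ top₁ top₂ =
  mtop-from-tops Ψ-ideal lowest no-wall (<-wellFounded p) 1≤p p+1≤ℓ top₁ top₂
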